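{- Let $G$ be a finite, simple, connected graph and let $u,v$ be a good pair in $G$. If a vertex $z$ is not in the line $\overline{uv}$, then $d_G(z,u)=d_G(z,v)$.
   Context: $d_G$ is the shortest-path distance. A vertex $z$ is between $u$ and $v$ if $d_G(u,v)=d_G(u,z)+d_G(z,v)$. For distinct vertices $u,v$, the line $\overline{uv}$ is the set of all vertices $z$ such that one of $u,v,z$ is between the other two. A good pair is a pair of vertices $u,v$ with $d_G(u,v)=2$ such that some common neighbour $c$ of $u$ and $v$ satisfies $\overline{uc}=\overline{cv}$. -}

module Defs where

open import Data.Nat using (ℕ; zero; suc; _+_; _≤_)
open import Data.Fin using (Fin)
open import Data.Product using (Σ; ∃; _×_; _,_)
open import Data.Sum using (_⊎_)
open import Relation.Nullary using (¬_)
open import Relation.Binary.PropositionalEquality using (_≡_)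

record Graph : Set₁ where
  field
    n     : ℕ
    Adj   : Fin n → Fin n → Set
    sym   : ∀ {x y} → Adj x y → Adj y x
    irrefl : ∀ {x} → ¬ Adj x x

module _ (G : Graph) where
  open Graph G

  Vertex : Set
  Vertex = Fin n

  data Walk : Vertex → Vertex → ℕ → Set where
    here : ∀ {x} → Walk x x zero
    step : ∀ {x y z k} → Adj x y → Walk y z k → Walk x z (suc k)

  Connected : Set
  Connected = ∀ x y → ∃ λ k → Walk x y k

  IsDistance : (Vertex → Vertex → ℕ) → Set
  IsDistance d = ∀ x y → Walk x y (d x y) × (∀ k → Walk x y k → d x y ≤ k)

  module _ (d : Vertex → Vertex → ℕ) where
    Between : Vertex → Vertex → Vertex → Set
    Between x y z = d x y ≡ d x z + d z y

    InLine : Vertex → Vertex → Vertex → Set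
    InLine x y z = Between x y z ⊎ Between z y x ⊎ Between x z y

    GoodPair : Vertex → Vertex → Set
    GoodPair u v = d u v ≡ 2 × Σ Vertex λ c → Adj u c × Adj c v ×
                     (∀ z → (InLine u c z → InLine c v z) × (InLine c v z → InLine u c z))

-- Let c be the middle vertex of the good pair u, v and write p, a, q for the
-- distances from z to u, c, v. Along the edges u–c and c–v these change by at
-- most one, and z lies on the line through an edge exactly when the distances
-- to its two ends differ. The good-pair condition therefore says p ≠ a iff
-- a ≠ q, which leaves p = q or |p − q| = 2 = d(u, v); the latter puts z on
-- the line through u and v.
module Submission where

open import Defs
open import Relation.Nullary using (¬_)
open import Relation.Binary.PropositionalEquality
  using (_≡_; _≢_; refl; sym; trans; cong; cong₂; module ≡-Reasoning)
open import Data.Nat using (ℕ; zero; suc; _+_; _≤_; z≤n; s≤s)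
open import Data.Nat.Properties using (≤-antisym; +-comm; 1+n≢n)
open import Data.Product using (_,_; proj₁; proj₂)
open import Data.Sum using (_⊎_; inj₁; inj₂; [_,_]′)
open import Function using (id)
open import Data.Empty using (⊥-elim)

n≢1+n : ∀ {n} → n ≢ suc n
n≢1+n e = 1+n≢n (sym e)

1≢n+n : ∀ {n} → 1 ≢ n + n
1≢n+n {zero}        ()
1≢n+n {suc zero}    ()
1≢n+n {suc (suc n)} ()

n≢n+1 : ∀ {n} → n ≢ n + 1
n≢n+1 {n} e = n≢1+n (trans e (+-comm n 1))

data Near : ℕ → ℕ → Set where
  same  : ∀ {n} → Near n n
  above : ∀ {n} → Near (suc n) n
  below : ∀ {n} → Near n (suc n)

near-suc : ∀ {m n} → Near m n → Near (suc m) (suc n)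
near-suc same  = same
near-suc above = above
near-suc below = below

near : ∀ m n → m ≤ suc n → n ≤ suc m → Near m n
near zero          zero          _         _         = same
near zero          (suc zero)    _         _         = below
near zero          (suc (suc n)) _         (s≤s ())
near (suc zero)    zero          _         _         = above
near (suc (suc m)) zero          (s≤s ())  _
near (suc m)       (suc n)       (s≤s m≤n) (s≤s n≤m) = near-suc (near m n m≤n n≤m)

near-near-cases : ∀ {p a q} → Near p a → Near a q →
                  (p ≢ a → a ≢ q) → (a ≢ q → p ≢ a) →
                  p ≡ q ⊎ q ≡ 2 + p ⊎ p ≡ 2 + q
near-near-cases same  same  _ _ = inj₁ refl
near-near-cases same  above _ g = ⊥-elim (g 1+n≢n refl)
near-near-cases same  below _ g = ⊥-elim (g n≢1+n refl)
near-near-cases above same  f _ = ⊥-elim (f 1+n≢n refl)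
near-near-cases below same  f _ = ⊥-elim (f n≢1+n refl)
near-near-cases above above _ _ = inj₂ (inj₂ refl)
near-near-cases below below _ _ = inj₂ (inj₁ refl)
near-near-cases above below _ _ = inj₁ refl
near-near-cases below above _ _ = inj₁ refl

near-≢⇒suc : ∀ {m n} → Near m n → m ≢ n → m ≡ suc n ⊎ n ≡ suc m
near-≢⇒suc same  ≢ = ⊥-elim (≢ refl)
near-≢⇒suc above _ = inj₁ refl
near-≢⇒suc below _ = inj₂ refl

module Metric (G : Graph) (d : Vertex G → Vertex G → ℕ) (isDistance : IsDistance G d) where
  open Graph G using (Adj; irrefl) renaming (sym to Adj-sym)

  walk-snoc : ∀ {x y z k} → Walk G x y k → Adj y z → Walk G x z (suc k)
  walk-snoc here       yz = step yz here
  walk-snoc (step e w) yz = step e (walk-snoc w yz)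

  walk-reverse : ∀ {x y k} → Walk G x y k → Walk G y x k
  walk-reverse here       = here
  walk-reverse (step e w) = walk-snoc (walk-reverse w) (Adj-sym e)

  shortest : ∀ x y → Walk G x y (d x y)
  shortest x y = proj₁ (isDistance x y)

  minimal : ∀ {x y k} → Walk G x y k → d x y ≤ k
  minimal {x} {y} = proj₂ (isDistance x y) _

  d-sym : ∀ x y → d x y ≡ d y x
  d-sym x y = ≤-antisym (minimal (walk-reverse (shortest y x)))
                        (minimal (walk-reverse (shortest x y)))

  d-adj : ∀ {x y} → Adj x y → d x y ≡ 1
  d-adj {x} {y} xy = ≤-antisym (minimal (step xy here)) (positive (shortest x y))
    where
    positive : ∀ {k} → Walk G x y k → 1 ≤ k
    positive here       = ⊥-elim (irrefl xy)
    positive (step _ _) = s≤s z≤n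

  d-adj-near : ∀ {x y} z → Adj x y → Near (d z x) (d z y)
  d-adj-near {x} {y} z xy =
    near (d z x) (d z y) (minimal (walk-snoc (shortest z y) (Adj-sym xy)))
                         (minimal (walk-snoc (shortest z x) xy))

  inLine-edge⇒≢ : ∀ {x y z} → Adj x y → InLine G d x y z → d z x ≢ d z y
  inLine-edge⇒≢ {x} {y} {z} xy (inj₁ xzy) eq = 1≢n+n {d z y} (begin
    1               ≡⟨ sym (d-adj xy) ⟩
    d x y           ≡⟨ xzy ⟩
    d x z + d z y   ≡⟨ cong (_+ d z y) (trans (d-sym x z) eq) ⟩
    d z y + d z y   ∎)
    where open ≡-Reasoning
  inLine-edge⇒≢ {x} {y} {z} xy (inj₂ (inj₁ zxy)) eq = n≢n+1 {d z y} (begin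
    d z y           ≡⟨ zxy ⟩
    d z x + d x y   ≡⟨ cong₂ _+_ eq (d-adj xy) ⟩
    d z y + 1       ∎)
    where open ≡-Reasoning
  inLine-edge⇒≢ {x} {y} {z} xy (inj₂ (inj₂ xyz)) eq = n≢1+n {d z x} (begin
    d z x           ≡⟨ d-sym z x ⟩
    d x z           ≡⟨ xyz ⟩
    d x y + d y z   ≡⟨ cong₂ _+_ (d-adj xy) (trans (d-sym y z) (sym eq)) ⟩
    1 + d z x       ∎)
    where open ≡-Reasoning

  ≢⇒inLine-edge : ∀ {x y} z → Adj x y → d z x ≢ d z y → InLine G d x y z
  ≢⇒inLine-edge {x} {y} z xy ≢ with near-≢⇒suc (d-adj-near z xy) ≢
  ... | inj₁ x-farther = inj₂ (inj₂ (begin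
    d x z           ≡⟨ d-sym x z ⟩
    d z x           ≡⟨ x-farther ⟩
    1 + d z y       ≡⟨ cong₂ _+_ (sym (d-adj xy)) (d-sym z y) ⟩
    d x y + d y z   ∎))
    where open ≡-Reasoning
  ... | inj₂ y-farther = inj₂ (inj₁ (begin
    d z y           ≡⟨ y-farther ⟩
    1 + d z x       ≡⟨ +-comm 1 (d z x) ⟩
    d z x + 1       ≡⟨ cong (d z x +_) (sym (d-adj xy)) ⟩
    d z x + d x y   ∎))
    where open ≡-Reasoning

  inLine-at-distance-2 : ∀ {x y} z → d x y ≡ 2 →
                         d z y ≡ 2 + d z x ⊎ d z x ≡ 2 + d z y → InLine G d x y z
  inLine-at-distance-2 {x} {y} z xy≡2 (inj₁ y-farther) = inj₂ (inj₁ (begin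
    d z y           ≡⟨ y-farther ⟩
    2 + d z x       ≡⟨ +-comm 2 (d z x) ⟩
    d z x + 2       ≡⟨ cong (d z x +_) (sym xy≡2) ⟩
    d z x + d x y   ∎))
    where open ≡-Reasoning
  inLine-at-distance-2 {x} {y} z xy≡2 (inj₂ x-farther) = inj₂ (inj₂ (begin
    d x z           ≡⟨ d-sym x z ⟩
    d z x           ≡⟨ x-farther ⟩
    2 + d z y       ≡⟨ cong₂ _+_ (sym xy≡2) (d-sym z y) ⟩
    d x y + d y z   ∎))
    where open ≡-Reasoning

lemma1 : (G : Graph) → Connected G →
         (d : Vertex G → Vertex G → ℕ) → IsDistance G d →
         (u v : Vertex G) → GoodPair G d u v →
         (z : Vertex G) → ¬ InLine G d u v z → d z u ≡ d z v
lemma1 G _ d isDistance u v (uv≡2 , c , uc , cv , sameLine) z z∉uv =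
  [ id , (λ far → ⊥-elim (z∉uv (inLine-at-distance-2 z uv≡2 far))) ]′
    (near-near-cases (d-adj-near z uc) (d-adj-near z cv)
      (λ p≢a → inLine-edge⇒≢ cv (proj₁ (sameLine z) (≢⇒inLine-edge z uc p≢a)))
      (λ a≢q → inLine-edge⇒≢ uc (proj₂ (sameLine z) (≢⇒inLine-edge z cv a≢q))))
  where open Metric G d isDistance
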